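{- Let $n$ be a power of two, $\alpha\in(0,1)$ with $n^{1-\alpha}$ a power of two, $\delta>0$, let $A,B$ be $n\times n$ $\delta$-bounded-difference matrices, and let $l\in\{n^{1-\alpha},n^{1-\alpha}/2,\dots,2\}$. For $i,j,k\in[n]$, if $k'_{l/2}\in K_{l/2}(i'_{l/2},j'_{l/2})$, then $k'_l\in K_l(i'_l,j'_l)$.
   Context: A matrix $X$ is $\delta$-bounded-difference if for all $i,j$ (whenever the entries exist) $|X_{i,j}-X_{i,j+1}|<\delta$ and $|X_{i,j}-X_{i+1,j}|<\delta$. $[n]=\{1,\dots,n\}$. For $l$ a power of two dividing $n$, partition $[n]$ into consecutive intervals of length $l$; for $i\in[n]$, $I_l(i)$ is the interval containing $i$ and $i'_l$ its smallest element; $[n]'_l=\{1,l+1,2l+1,\dots,n-l+1\}$. Define $\tilde C^l_{i,j}=\min_{k'_l\in[n]'_l}\{A_{i'_l,k'_l}+B_{k'_l,j'_l}\}$ and the candidate set $K_l(i'_l,j'_l)=\{k'_l\in[n]'_l : A_{i'_l,k'_l}+B_{k'_l,j'_l}\le \tilde C^l_{i'_l,j'_l}+8\delta l\}$.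
   Formalization: The entries of the matrices A and B and the parameter δ are rational. -}

module Defs where

open import Data.Nat as ℕ using (ℕ; zero; suc; _∸_; _^_; NonZero)
open import Data.Nat.Properties using (m^n≢0)
open import Data.Integer using (+_)
open import Data.Rational using (ℚ; _+_; _*_; _⊓_; _≤_; _<_; _/_)
open import Data.List using (List; []; _∷_; map; foldr; upTo)
open import Data.List.Membership.Propositional using (_∈_)

-- Matrices are indexed 1-based by natural numbers: an n × n matrix is a
-- function ℕ → ℕ → ℚ of which only the entries with indices in [n] matter.
Matrix : Set
Matrix = ℕ → ℕ → ℚ

InRange : ℕ → ℕ → Set
InRange n i = 1 ℕ.≤ i × i ℕ.≤ n
  where open import Data.Product using (_×_)

∣_∣ℚ : ℚ → ℚ
∣_∣ℚ = Data.Rational.∣_∣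

BoundedDiff : ℕ → ℚ → Matrix → Set
BoundedDiff n δ X =
  (∀ i j → 1 ℕ.≤ i → i ℕ.≤ n → 1 ℕ.≤ j → j ℕ.< n →
     ∣ X i j Data.Rational.- X i (suc j) ∣ℚ < δ) ×
  (∀ i j → 1 ℕ.≤ i → i ℕ.< n → 1 ℕ.≤ j → j ℕ.≤ n →
     ∣ X i j Data.Rational.- X (suc i) j ∣ℚ < δ)
  where open import Data.Product using (_×_)

toℚ : ℕ → ℚ
toℚ m = (+ m) / 1

IsPow2 : ℕ → Set
IsPow2 m = Σ ℕ λ e → m ≡ 2 ^ e
  where open import Data.Product using (Σ)
        open import Relation.Binary.PropositionalEquality using (_≡_)

-- Block length l ≠ 0 (the lemma only uses l = 2^q).
-- i'_l : the smallest element of the length-l interval containing i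
-- (intervals {1..l}, {l+1..2l}, ...).
start : (l : ℕ) → .{{NonZero l}} → ℕ → ℕ
start l i = ((i ∸ 1) ℕ./ l) ℕ.* l ℕ.+ 1

reps : (n l : ℕ) → .{{NonZero l}} → List ℕ
reps n l = map (λ t → t ℕ.* l ℕ.+ 1) (upTo (n ℕ./ l))

-- minimum of a list of rationals (with a default for the empty list,
-- which never occurs for the lists used below, since l ∣ n and n ≥ l ≥ 1)
minList : ℚ → List ℚ → ℚ
minList d [] = d
minList d (x ∷ xs) = foldr _⊓_ x xs


Ctilde : (n l : ℕ) → .{{NonZero l}} → Matrix → Matrix → ℕ → ℕ → ℚ
Ctilde n l A B i j =
  minList (A (start l i) 1 + B 1 (start l j))
          (map (λ k → A (start l i) k + B k (start l j)) (reps n l))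

InK : (n l : ℕ) → .{{NonZero l}} → ℚ → Matrix → Matrix → ℕ → ℕ → ℕ → Set
InK n l δ A B i j k =
  (k ∈ reps n l) ×
  (A i k + B k j ≤ Ctilde n l A B i j + toℚ 8 * δ * toℚ l)
  where open import Data.Product using (_×_)

start₂ : ℕ → ℕ → ℕ
start₂ e = start (2 ^ e) {{m^n≢0 2 e}}

InK₂ : (n : ℕ) → (e : ℕ) → ℚ → Matrix → Matrix → ℕ → ℕ → ℕ → Set
InK₂ n e = InK n (2 ^ e) {{m^n≢0 2 e}}

-- Let h = l/2. The h-block of an index is one half of its l-block, so i'_h, j'_h, k'_h exceed
-- i'_l, j'_l, k'_l by at most h, and by bounded differences every entry involved moves by at
-- most hδ. Hence A(i'_l,k'_l) + B(k'_l,j'_l) ≤ A(i'_h,k'_h) + B(k'_h,j'_h) + 4hδ ≤ C̃^h + 12hδ.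
-- Every l-representative is also an h-representative, so comparing at a minimiser of C̃^l
-- gives C̃^h(i'_h,j'_h) ≤ C̃^l(i'_l,j'_l) + 2hδ. The total error 14hδ is below 8δl = 16hδ.
module Submission where

module Blocks where

  open import Defs
  open import Data.Nat
  open import Data.Nat.Properties
  open import Data.Nat.DivMod
  open import Data.Nat.Divisibility using (_∣_; divides)
  open import Data.Nat.Solver using (module +-*-Solver)
  open import Data.List.Membership.Propositional using (_∈_)
  open import Data.List.Membership.Propositional.Properties using (∈-map⁺; ∈-map⁻; ∈-upTo⁺; ∈-upTo⁻)
  open import Data.Product using (_×_; _,_; ∃-syntax)
  open import Relation.Binary.PropositionalEquality

  module _ (l : ℕ) .{{_ : NonZero l}} where

    1≤start : ∀ x → 1 ≤ start l x
    1≤start x = m≤n+m 1 _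

    start≤ : ∀ {x} → 1 ≤ x → start l x ≤ x
    start≤ {suc x} _ = subst (_≤ suc x) (+-comm 1 _) (s≤s (m/n*n≤m x l))

    start-idem : ∀ x → start l (start l x) ≡ start l x
    start-idem x = cong (λ q → q * l + 1) (begin
      ((x ∸ 1) / l * l + 1 ∸ 1) / l  ≡⟨ cong (_/ l) (m+n∸n≡m ((x ∸ 1) / l * l) 1) ⟩
      (x ∸ 1) / l * l / l            ≡⟨ m*n/n≡m ((x ∸ 1) / l) l ⟩
      (x ∸ 1) / l                    ∎)
      where open ≡-Reasoning

    start-inRange : ∀ {n x} → InRange n x → InRange n (start l x)
    start-inRange {x = x} (1≤x , x≤n) = 1≤start x , ≤-trans (start≤ 1≤x) x≤n

    ∈-reps⁺ : ∀ {n} t → suc t * l ≤ n → t * l + 1 ∈ reps n l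
    ∈-reps⁺ {n} t fits = ∈-map⁺ (λ t → t * l + 1) (∈-upTo⁺ (begin
      suc t          ≡⟨ m*n/n≡m (suc t) l ⟨
      suc t * l / l  ≤⟨ /-monoˡ-≤ l fits ⟩
      n / l          ∎))
      where open ≤-Reasoning hiding (start)

    ∈-reps⁻ : ∀ {n k} → k ∈ reps n l → ∃[ t ] suc t * l ≤ n × k ≡ t * l + 1
    ∈-reps⁻ {n} k∈ with ∈-map⁻ (λ t → t * l + 1) k∈
    ... | t , t∈ , k≡ = t , ≤-trans (*-monoˡ-≤ l (∈-upTo⁻ t∈)) (m/n*n≤m n l) , k≡

    reps-range : ∀ {n k} → k ∈ reps n l → InRange n k
    reps-range k∈ with ∈-reps⁻ k∈
    ... | t , fits , refl = m≤n+m 1 (t * l) , (begin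
      t * l + 1   ≡⟨ +-comm (t * l) 1 ⟩
      1 + t * l   ≤⟨ +-monoˡ-≤ (t * l) (>-nonZero⁻¹ l) ⟩
      suc t * l   ≤⟨ fits ⟩
      _           ∎)
      where open ≤-Reasoning hiding (start)

    start∈reps : ∀ {n x} → l ∣ n → InRange n x → start l x ∈ reps n l
    start∈reps {x = suc x} (divides q refl) (_ , x<q*l) =
      ∈-reps⁺ (x / l) (*-monoˡ-≤ l (*-cancelʳ-< l (x / l) q (<-≤-trans (s≤s (m/n*n≤m x l)) x<q*l)))

  ^-monoʳ-∣ : ∀ b {e f} → e ≤ f → b ^ e ∣ b ^ f
  ^-monoʳ-∣ b {e} {f} e≤f = divides (b ^ (f ∸ e)) (begin
    b ^ f              ≡⟨ cong (b ^_) (m∸n+n≡m e≤f) ⟨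
    b ^ (f ∸ e + e)    ≡⟨ ^-distribˡ-+-* b (f ∸ e) e ⟩
    b ^ (f ∸ e) * b ^ e ∎)
    where open ≡-Reasoning

  reps-⊆ : ∀ c l .{{_ : NonZero c}} .{{_ : NonZero l}} {n k} → k ∈ reps n (c * l) {{m*n≢0 c l}} → k ∈ reps n l
  reps-⊆ c l {n} k∈ with ∈-reps⁻ (c * l) {{m*n≢0 c l}} k∈
  ... | t , fits , refl = subst (_∈ reps n l) (cong (_+ 1) (*-assoc t c l)) (∈-reps⁺ l (t * c) (begin
    suc (t * c) * l  ≤⟨ *-monoˡ-≤ l (+-monoˡ-≤ (t * c) (>-nonZero⁻¹ c)) ⟩
    suc t * c * l    ≡⟨ *-assoc (suc t) c l ⟩
    suc t * (c * l)  ≤⟨ fits ⟩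
    n                ∎))
    where open ≤-Reasoning

  14h≤16h : ∀ h → ((h + h) + (h + h)) + (h * 8 + (h + h)) ≤ (2 * h) * 8
  14h≤16h h = begin
    ((h + h) + (h + h)) + (h * 8 + (h + h))            ≤⟨ m≤m+n _ (h + h) ⟩
    ((h + h) + (h + h)) + (h * 8 + (h + h)) + (h + h)  ≡⟨ solve 1 (λ h → ((h :+ h) :+ (h :+ h)) :+ (h :* con 8 :+ (h :+ h)) :+ (h :+ h)
                                                                   := (con 2 :* h) :* con 8) refl h ⟩
    (2 * h) * 8                                        ∎
    where
    open ≤-Reasoning
    open +-*-Solver

  -- The h-block of x is the first or second half of its 2h-block, according to the parity of (x ∸ 1) / h.
  start-refine : ∀ h .{{_ : NonZero h}} x → ∃[ d ] d ≤ h × d + start (2 * h) {{m*n≢0 2 h}} x ≡ start h x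
  start-refine h x = a % 2 * h , ≤-trans (*-monoˡ-≤ h (≤-pred (m%n<n a 2))) (≤-reflexive (*-identityˡ h)) , (begin
    a % 2 * h + ((x ∸ 1) / (2 * h) * (2 * h) + 1)  ≡⟨ cong (λ q → a % 2 * h + (q * (2 * h) + 1)) a/2≡ ⟨
    a % 2 * h + (a / 2 * (2 * h) + 1)              ≡⟨ solve 3 (λ r q h → r :* h :+ (q :* (con 2 :* h) :+ con 1)
                                                                     := (r :+ q :* con 2) :* h :+ con 1) refl (a % 2) (a / 2) h ⟩
    (a % 2 + a / 2 * 2) * h + 1                    ≡⟨ cong (λ q → q * h + 1) (m≡m%n+[m/n]*n a 2) ⟨
    a * h + 1                                      ∎)
    where
    open ≡-Reasoning
    open +-*-Solver
    instance
      _ = m*n≢0 2 h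
      _ = m*n≢0 h 2
    a = (x ∸ 1) / h
    a/2≡ : a / 2 ≡ (x ∸ 1) / (2 * h)
    a/2≡ = trans (m/n/o≡m/[n*o] (x ∸ 1) h 2) (/-congʳ (*-comm h 2))

module Slack where

  open import Defs
  open import Algebra.Bundles using (Ring; CommutativeMonoid)
  open import Data.Nat as ℕ using (ℕ; zero; suc)
  import Data.Nat.Properties as ℕ
  open import Data.Nat.Coprimality as Coprime using (1-coprimeTo)
  import Data.Integer as ℤ
  open import Data.Rational using (ℚ; mkℚ; 0ℚ; 1ℚ; _+_; _-_; _*_; _/_; -_; _≤_; _<_; ∣_∣)
  open import Data.Rational.Properties
  open import Data.Rational.Solver using (module +-*-Solver)
  open import Data.Product using (_×_; _,_)
  open import Relation.Binary.PropositionalEquality using (_≡_; refl; cong; sym; trans; subst; module ≡-Reasoning)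
  open import Algebra.Properties.CommutativeSemigroup (CommutativeMonoid.commutativeSemigroup +-0-commutativeMonoid)
    using (interchange)
  open import Algebra.Properties.Semiring.Mult (Ring.semiring +-*-ring)
    using (×-homo-+; ×-assocˡ; ×-assoc-*)
    renaming (_×_ to _·_)
    public
  open +-*-Solver using (solve; _:=_; _:+_; _:-_; :-_)

  toℚ-suc : ∀ m → toℚ (suc m) ≡ 1ℚ + toℚ m
  toℚ-suc zero    = refl
  toℚ-suc (suc m) = begin
    toℚ (suc (suc m))              ≡⟨ cong (λ z → ℤ.+ suc z / 1) (ℕ.*-identityʳ (suc m)) ⟨
    1ℚ + mkℚ (ℤ.+ suc m) 0 coprime ≡⟨ cong (λ q → 1ℚ + q) (normalize-coprime coprime) ⟨
    1ℚ + toℚ (suc m)               ∎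
    where
    open ≡-Reasoning
    coprime = Coprime.sym (1-coprimeTo (suc m))

  toℚ≡·1 : ∀ m → toℚ m ≡ m · 1ℚ
  toℚ≡·1 zero    = refl
  toℚ≡·1 (suc m) = trans (toℚ-suc m) (cong (λ q → 1ℚ + q) (toℚ≡·1 m))

  toℚ*≡· : ∀ m q → toℚ m * q ≡ m · q
  toℚ*≡· m q = begin
    toℚ m * q     ≡⟨ cong (_* q) (toℚ≡·1 m) ⟩
    (m · 1ℚ) * q  ≡⟨ ×-assoc-* m 1ℚ q ⟩
    m · (1ℚ * q)  ≡⟨ cong (m ·_) (*-identityˡ q) ⟩
    m · q         ∎
    where open ≡-Reasoning

  toℚ*q*toℚ≡· : ∀ a q b → toℚ a * q * toℚ b ≡ (b ℕ.* a) · q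
  toℚ*q*toℚ≡· a q b = begin
    toℚ a * q * toℚ b    ≡⟨ *-comm (toℚ a * q) (toℚ b) ⟩
    toℚ b * (toℚ a * q)  ≡⟨ cong (toℚ b *_) (toℚ*≡· a q) ⟩
    toℚ b * (a · q)      ≡⟨ toℚ*≡· b (a · q) ⟩
    b · (a · q)          ≡⟨ ×-assocˡ q b a ⟩
    (b ℕ.* a) · q        ∎
    where open ≡-Reasoning

  ·-nonNeg : ∀ m {q} → 0ℚ ≤ q → 0ℚ ≤ m · q
  ·-nonNeg zero    0≤q = ≤-refl
  ·-nonNeg (suc m) 0≤q = +-mono-≤ 0≤q (·-nonNeg m 0≤q)

  ·-monoˡ-≤ : ∀ {m n q} → 0ℚ ≤ q → m ℕ.≤ n → m · q ≤ n · q
  ·-monoˡ-≤ {n = n} 0≤q ℕ.z≤n       = ·-nonNeg n 0≤q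
  ·-monoˡ-≤ {q = q} 0≤q (ℕ.s≤s m≤n) = +-monoʳ-≤ q (·-monoˡ-≤ 0≤q m≤n)

  p≤∣p∣ : ∀ p → p ≤ ∣ p ∣
  p≤∣p∣ (mkℚ (ℤ.+ _) _ _)       = ≤-refl
  p≤∣p∣ p@(mkℚ ℤ.-[1+ _ ] _ _) = ≤-trans (<⇒≤ (negative⁻¹ p)) (0≤∣p∣ p)

  ∣p-q∣≤r⇒p≤q+r : ∀ {p q r} → ∣ p - q ∣ ≤ r → p ≤ q + r
  ∣p-q∣≤r⇒p≤q+r {p} {q} {r} ∣p-q∣≤r = begin
    p            ≡⟨ solve 2 (λ p q → p := q :+ (p :- q)) refl p q ⟩
    q + (p - q)  ≤⟨ +-monoʳ-≤ q (≤-trans (p≤∣p∣ (p - q)) ∣p-q∣≤r) ⟩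
    q + r        ∎
    where open ≤-Reasoning

  ∣p-q∣≤r⇒q≤p+r : ∀ {p q r} → ∣ p - q ∣ ≤ r → q ≤ p + r
  ∣p-q∣≤r⇒q≤p+r {p} {q} {r} ∣p-q∣≤r = begin
    q              ≡⟨ solve 2 (λ p q → q := p :+ (:- (p :- q))) refl p q ⟩
    p + - (p - q)  ≤⟨ +-monoʳ-≤ p (≤-trans (p≤∣p∣ (- (p - q))) (≤-reflexive (∣-p∣≡∣p∣ (p - q)))) ⟩
    p + ∣ p - q ∣  ≤⟨ +-monoʳ-≤ p ∣p-q∣≤r ⟩
    p + r          ∎
    where open ≤-Reasoning

  -- Error terms are natural multiples m · δ, so that combining bounds is arithmetic in ℕ.
  module _ (δ : ℚ) where

    ≤-slack-trans : ∀ {a b c} m n → a ≤ b + m · δ → b ≤ c + n · δ → a ≤ c + (m ℕ.+ n) · δ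
    ≤-slack-trans {c = c} m n a≤b b≤c = ≤-trans a≤b (≤-trans (+-monoˡ-≤ (m · δ) b≤c) (≤-reflexive (begin
      (c + n · δ) + m · δ  ≡⟨ +-assoc c (n · δ) (m · δ) ⟩
      c + (n · δ + m · δ)  ≡⟨ cong (c +_) (+-comm (n · δ) (m · δ)) ⟩
      c + (m · δ + n · δ)  ≡⟨ cong (c +_) (×-homo-+ δ m n) ⟨
      c + (m ℕ.+ n) · δ    ∎)))
      where open ≡-Reasoning

    ≤-slack-+ : ∀ {a b c d} m n → a ≤ b + m · δ → c ≤ d + n · δ → a + c ≤ (b + d) + (m ℕ.+ n) · δ
    ≤-slack-+ {b = b} {d = d} m n a≤b c≤d = ≤-trans (+-mono-≤ a≤b c≤d) (≤-reflexive (begin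
      (b + m · δ) + (d + n · δ)  ≡⟨ interchange b (m · δ) d (n · δ) ⟩
      (b + d) + (m · δ + n · δ)  ≡⟨ cong ((b + d) +_) (×-homo-+ δ m n) ⟨
      (b + d) + (m ℕ.+ n) · δ    ∎))
      where open ≡-Reasoning

    ≤-slack-weaken : ∀ {a b m n} → 0ℚ ≤ δ → m ℕ.≤ n → a ≤ b + m · δ → a ≤ b + n · δ
    ≤-slack-weaken {b = b} 0≤δ m≤n a≤b = ≤-trans a≤b (+-monoʳ-≤ b (·-monoˡ-≤ 0≤δ m≤n))

    Close : ℕ → ℚ → ℚ → Set
    Close m a b = a ≤ b + m · δ × b ≤ a + m · δ

    Close-refl : ∀ a → Close 0 a a
    Close-refl a = a≤a+0 , a≤a+0
      where a≤a+0 = ≤-reflexive (sym (+-identityʳ a))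

    Close-step : ∀ {a b} → ∣ a - b ∣ < δ → Close 1 a b
    Close-step {a} ∣a-b∣<δ = ∣p-q∣≤r⇒p≤q+r {a} ∣a-b∣≤1·δ , ∣p-q∣≤r⇒q≤p+r {a} ∣a-b∣≤1·δ
      where ∣a-b∣≤1·δ = ≤-trans (<⇒≤ ∣a-b∣<δ) (≤-reflexive (sym (+-identityʳ δ)))

    Close-trans : ∀ {a b c} m n → Close m a b → Close n b c → Close (m ℕ.+ n) a c
    Close-trans {a} {b} {c} m n (a≤b , b≤a) (b≤c , c≤b) =
      ≤-slack-trans {a} {b} {c} m n a≤b b≤c ,
      subst (λ k → c ≤ a + k · δ) (ℕ.+-comm n m) (≤-slack-trans {c} {b} {a} n m c≤b b≤a)

    Close-+ : ∀ {a b c d} m n → Close m a b → Close n c d → Close (m ℕ.+ n) (a + c) (b + d)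
    Close-+ {a} {b} {c} {d} m n (a≤b , b≤a) (c≤d , d≤c) =
      ≤-slack-+ {a} {b} {c} {d} m n a≤b c≤d , ≤-slack-+ {b} {a} {d} {c} m n b≤a d≤c

    Close-weaken : ∀ {a b m n} → 0ℚ ≤ δ → m ℕ.≤ n → Close m a b → Close n a b
    Close-weaken {a} {b} 0≤δ m≤n (a≤b , b≤a) =
      ≤-slack-weaken {a} {b} 0≤δ m≤n a≤b , ≤-slack-weaken {b} {a} 0≤δ m≤n b≤a

    Close-walk : ∀ (f : ℕ → ℚ) {lo hi} → (∀ t → lo ℕ.≤ t → t ℕ.< hi → ∣ f t - f (suc t) ∣ < δ) →
                 ∀ d {x y} → lo ℕ.≤ x → y ℕ.≤ hi → d ℕ.+ x ≡ y → Close d (f x) (f y)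
    Close-walk f step zero    {x} _ _ refl = Close-refl (f x)
    Close-walk f step (suc d) {x} lo≤x y≤hi refl =
      Close-trans 1 d (Close-step (step x lo≤x (ℕ.<-≤-trans (ℕ.s≤s (ℕ.m≤n+m x d)) y≤hi)))
                      (Close-walk f step d (ℕ.m≤n⇒m≤1+n lo≤x) y≤hi (ℕ.+-suc d x))

module MinPlus where

  open import Defs
  open import Data.Nat as ℕ using (ℕ; NonZero)
  open import Data.Nat.Divisibility using (_∣_)
  import Data.Nat.Properties as ℕ
  open import Data.Rational using (ℚ; 0ℚ; _+_; _*_; _⊓_; _≤_)
  open import Data.Rational.Properties using (≤-reflexive; ≤-trans; p⊓q≤p; p⊓q≤q; ⊓-sel; module ≤-Reasoning)
  open import Data.Sum using (_⊎_; inj₁; inj₂; [_,_]′)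
  open import Data.List using (_∷_; map)
  open import Data.List.Relation.Unary.Any as Any using (Any; here; there)
  open import Data.List.Properties using (foldr-preservesᵒ)
  open import Data.List.Membership.Propositional.Properties using (∈-map⁺; ∈-map⁻; foldr-selective)
  open import Data.Product using (_×_; _,_; proj₁; proj₂; ∃-syntax)
  open import Data.List.Membership.Propositional using (_∈_)
  open import Relation.Binary.PropositionalEquality using (_≡_; cong; cong₂; sym; subst₂)
  open Blocks
  open Slack

  minList-≤ : ∀ {d x xs} → x ∈ xs → minList d xs ≤ x
  minList-≤ {x = x} {xs = y ∷ ys} x∈ = foldr-preservesᵒ {P = _≤ x} ⊓-≤ y ys (head-or-tail x∈)
    where
    ⊓-≤ : ∀ p q → p ≤ x ⊎ q ≤ x → p ⊓ q ≤ x
    ⊓-≤ p q = [ ≤-trans (p⊓q≤p p q) , ≤-trans (p⊓q≤q p q) ]′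
    head-or-tail : x ∈ y ∷ ys → y ≤ x ⊎ Any (_≤ x) ys
    head-or-tail (here x≡y)   = inj₁ (≤-reflexive (sym x≡y))
    head-or-tail (there x∈ys) = inj₂ (Any.map (λ x≡z → ≤-reflexive (sym x≡z)) x∈ys)

  minList-∈ : ∀ {d x xs} → x ∈ xs → minList d xs ∈ xs
  minList-∈ {xs = y ∷ ys} _ = [ here , there ]′ (foldr-selective ⊓-sel y ys)

  pathWeight : Matrix → Matrix → ℕ → ℕ → ℕ → ℚ
  pathWeight A B i k j = A i k + B k j

  Ctilde-start : ∀ n l .{{_ : NonZero l}} A B i j → Ctilde n l A B (start l i) (start l j) ≡ Ctilde n l A B i j
  Ctilde-start n l A B i j =
    cong₂ (λ i′ j′ → minList (pathWeight A B i′ 1 j′) (map (λ k → pathWeight A B i′ k j′) (reps n l)))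
          (start-idem l i) (start-idem l j)

  Ctilde-attained : ∀ {n} l .{{_ : NonZero l}} A B {i} j → l ∣ n → InRange n i →
                    ∃[ k ] k ∈ reps n l × Ctilde n l A B i j ≡ pathWeight A B (start l i) k (start l j)
  Ctilde-attained l A B {i} j l∣n i∈ = ∈-map⁻ weight (minList-∈ (∈-map⁺ weight (start∈reps l l∣n i∈)))
    where
    weight : ℕ → ℚ
    weight k = pathWeight A B (start l i) k (start l j)

  module _ {n δ} (X : Matrix) (bd : BoundedDiff n δ X) where

    Close-vertical : ∀ d {x x′ y} → 1 ℕ.≤ y → y ℕ.≤ n → 1 ℕ.≤ x → x′ ℕ.≤ n → d ℕ.+ x ≡ x′ →
                     Close δ d (X x y) (X x′ y)
    Close-vertical d {y = y} 1≤y y≤n = Close-walk δ (λ t → X t y) (λ t 1≤t t<n → proj₂ bd t y 1≤t t<n 1≤y y≤n) d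

    Close-horizontal : ∀ d {x y y′} → 1 ℕ.≤ x → x ℕ.≤ n → 1 ℕ.≤ y → y′ ℕ.≤ n → d ℕ.+ y ≡ y′ →
                       Close δ d (X x y) (X x y′)
    Close-horizontal d {x} 1≤x x≤n = Close-walk δ (X x) (λ t 1≤t t<n → proj₁ bd x t 1≤x x≤n 1≤t t<n) d

  module _ {n δ} (0≤δ : 0ℚ ≤ δ) (X : Matrix) (bd : BoundedDiff n δ X) (h : ℕ) .{{_ : NonZero h}} where

    private instance
      2h≢0 : NonZero (2 ℕ.* h)
      2h≢0 = ℕ.m*n≢0 2 h

    Close-refine-row : ∀ {x y} → InRange n x → 1 ℕ.≤ y → y ℕ.≤ n →
                       Close δ h (X (start (2 ℕ.* h) x) y) (X (start h x) y)
    Close-refine-row {x} x∈ 1≤y y≤n with start-refine h x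
    ... | d , d≤h , d+x₂≡x₁ = Close-weaken δ 0≤δ d≤h
      (Close-vertical X bd d 1≤y y≤n (1≤start (2 ℕ.* h) x) (proj₂ (start-inRange h x∈)) d+x₂≡x₁)

    Close-refine-col : ∀ {x y} → 1 ℕ.≤ x → x ℕ.≤ n → InRange n y →
                       Close δ h (X x (start (2 ℕ.* h) y)) (X x (start h y))
    Close-refine-col {y = y} 1≤x x≤n y∈ with start-refine h y
    ... | d , d≤h , d+y₂≡y₁ = Close-weaken δ 0≤δ d≤h
      (Close-horizontal X bd d 1≤x x≤n (1≤start (2 ℕ.* h) y) (proj₂ (start-inRange h y∈)) d+y₂≡y₁)

  module _ {n δ} (0≤δ : 0ℚ ≤ δ) (A B : Matrix) (bdA : BoundedDiff n δ A) (bdB : BoundedDiff n δ B)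
           (h : ℕ) .{{_ : NonZero h}} where

    private instance
      2h≢0 : NonZero (2 ℕ.* h)
      2h≢0 = ℕ.m*n≢0 2 h

    pathWeight-refine-ends : ∀ {i j k} → InRange n i → InRange n j → InRange n k →
      Close δ (h ℕ.+ h) (pathWeight A B (start (2 ℕ.* h) i) k (start (2 ℕ.* h) j))
                        (pathWeight A B (start h i) k (start h j))
    pathWeight-refine-ends i∈ j∈ (1≤k , k≤n) =
      Close-+ δ h h (Close-refine-row 0≤δ A bdA h i∈ 1≤k k≤n) (Close-refine-col 0≤δ B bdB h 1≤k k≤n j∈)

    pathWeight-refine-middle : ∀ {i j k} → InRange n i → InRange n j → InRange n k →
      Close δ (h ℕ.+ h) (pathWeight A B i (start (2 ℕ.* h) k) j) (pathWeight A B i (start h k) j)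
    pathWeight-refine-middle (1≤i , i≤n) (1≤j , j≤n) k∈ =
      Close-+ δ h h (Close-refine-col 0≤δ A bdA h 1≤i i≤n k∈) (Close-refine-row 0≤δ B bdB h k∈ 1≤j j≤n)

    pathWeight-refine : ∀ {i j k} → InRange n i → InRange n j → InRange n k →
      Close δ ((h ℕ.+ h) ℕ.+ (h ℕ.+ h))
        (pathWeight A B (start (2 ℕ.* h) i) (start (2 ℕ.* h) k) (start (2 ℕ.* h) j))
        (pathWeight A B (start h i) (start h k) (start h j))
    pathWeight-refine i∈ j∈ k∈ = Close-trans δ (h ℕ.+ h) (h ℕ.+ h)
      (pathWeight-refine-ends i∈ j∈ (start-inRange (2 ℕ.* h) k∈))
      (pathWeight-refine-middle (start-inRange h i∈) (start-inRange h j∈) k∈)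

    Ctilde-refine : ∀ {i j} → 2 ℕ.* h ∣ n → InRange n i → InRange n j →
                    Ctilde n h A B i j ≤ Ctilde n (2 ℕ.* h) A B i j + (h ℕ.+ h) · δ
    Ctilde-refine {i} {j} 2h∣n i∈ j∈ with Ctilde-attained (2 ℕ.* h) A B j 2h∣n i∈
    ... | k , k∈ , min≡ = begin
      Ctilde n h A B i j
        ≤⟨ minList-≤ (∈-map⁺ (λ k → pathWeight A B (start h i) k (start h j)) (reps-⊆ 2 h k∈)) ⟩
      pathWeight A B (start h i) k (start h j)
        ≤⟨ proj₂ (pathWeight-refine-ends i∈ j∈ (reps-range (2 ℕ.* h) k∈)) ⟩
      pathWeight A B (start (2 ℕ.* h) i) k (start (2 ℕ.* h) j) + (h ℕ.+ h) · δ
        ≡⟨ cong (_+ (h ℕ.+ h) · δ) min≡ ⟨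
      Ctilde n (2 ℕ.* h) A B i j + (h ℕ.+ h) · δ
        ∎
      where open ≤-Reasoning hiding (start)

    InK-refine : 2 ℕ.* h ∣ n → ∀ i j k → InRange n i → InRange n j → InRange n k →
      InK n h δ A B (start h i) (start h j) (start h k) →
      InK n (2 ℕ.* h) δ A B (start (2 ℕ.* h) i) (start (2 ℕ.* h) j) (start (2 ℕ.* h) k)
    InK-refine 2h∣n i j k i∈ j∈ k∈ (_ , fine-bound) = start∈reps (2 ℕ.* h) 2h∣n k∈ , coarse-bound
      where
      wₗ = pathWeight A B (start (2 ℕ.* h) i) (start (2 ℕ.* h) k) (start (2 ℕ.* h) j)
      wₕ = pathWeight A B (start h i) (start h k) (start h j)
      Cₗ = Ctilde n (2 ℕ.* h) A B i j
      Cₕ = Ctilde n h A B i j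

      wₗ≤wₕ : wₗ ≤ wₕ + ((h ℕ.+ h) ℕ.+ (h ℕ.+ h)) · δ
      wₗ≤wₕ = proj₁ (pathWeight-refine i∈ j∈ k∈)

      wₕ≤Cₕ : wₕ ≤ Cₕ + (h ℕ.* 8) · δ
      wₕ≤Cₕ = subst₂ (λ C s → wₕ ≤ C + s) (Ctilde-start n h A B i j) (toℚ*q*toℚ≡· 8 δ h) fine-bound

      wₗ≤Cₗ : wₗ ≤ Cₗ + ((2 ℕ.* h) ℕ.* 8) · δ
      wₗ≤Cₗ = ≤-slack-weaken δ {wₗ} {Cₗ} 0≤δ (14h≤16h h)
        (≤-slack-trans δ {wₗ} {wₕ} {Cₗ} ((h ℕ.+ h) ℕ.+ (h ℕ.+ h)) (h ℕ.* 8 ℕ.+ (h ℕ.+ h)) wₗ≤wₕ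
          (≤-slack-trans δ {wₕ} {Cₕ} {Cₗ} (h ℕ.* 8) (h ℕ.+ h) wₕ≤Cₕ (Ctilde-refine 2h∣n i∈ j∈)))

      coarse-bound : wₗ ≤ Ctilde n (2 ℕ.* h) A B (start (2 ℕ.* h) i) (start (2 ℕ.* h) j) + toℚ 8 * δ * toℚ (2 ℕ.* h)
      coarse-bound = subst₂ (λ C s → wₗ ≤ C + s)
        (sym (Ctilde-start n (2 ℕ.* h) A B i j)) (sym (toℚ*q*toℚ≡· 8 δ (2 ℕ.* h))) wₗ≤Cₗ

open import Defs
open import Data.Nat using (ℕ; suc; _^_; _≤_; _<_)
open import Data.Rational using (ℚ; 0ℚ)
open import Relation.Binary.PropositionalEquality using (_≡_)

import Data.Nat.Properties as ℕ
open import Data.Rational.Properties using (<⇒≤)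
open import Relation.Binary.PropositionalEquality using (refl)
open Blocks
open MinPlus

lemma8 : (n m p r : ℕ) → n ≡ 2 ^ m → 0 < p → p < m →
         suc r ≤ p →
         (δ : ℚ) → Data.Rational._<_ 0ℚ δ →
         (A B : Matrix) → BoundedDiff n δ A → BoundedDiff n δ B →
         (i j k : ℕ) → InRange n i → InRange n j → InRange n k →
         InK₂ n r δ A B (start₂ r i) (start₂ r j) (start₂ r k) →
         InK₂ n (suc r) δ A B (start₂ (suc r) i) (start₂ (suc r) j) (start₂ (suc r) k)
lemma8 _ _ _ r refl _ p<m r<p _ 0<δ A B bdA bdB =
  InK-refine (<⇒≤ 0<δ) A B bdA bdB (2 ^ r) {{ℕ.m^n≢0 2 r}} (^-monoʳ-∣ 2 (ℕ.≤-trans r<p (ℕ.<⇒≤ p<m)))
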